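{- Let $G$ be a graph and $X,X_1,X_2\subseteq V(G)$ with $X=X_1\uplus X_2$ (disjoint union). Let $(A,B)$ be a split pair for $X$. Then there are split pairs $(A_i,B_i)$ for $X_i$, $i\in\{1,2\}$, that are nice with respect to $(A,B)$ and additionally satisfy $B_i\cap\overline X\subseteq B$ for $i\in\{1,2\}$.
   Context: Graphs are finite, simple, undirected; $\overline Y=V(G)\setminus Y$. For $v\in Y$, $\mathbf x_Y(v)\in\mathbb F_2^{\overline Y}$ has $w$-entry $1$ iff $vw\in E(G)$; $\mathbf x_Y(S)=\{\mathbf x_Y(v)\mid v\in S\}$. A split pair for $Y$ is $(A,B)$ with $A\subseteq Y$, $B\subseteq\overline Y$, $\mathbf x_Y(A)$ a linear basis of the $\mathbb F_2$-span of $\mathbf x_Y(Y)$, and $\mathbf x_{\overline Y}(B)$ a linear basis of the span of $\mathbf x_{\overline Y}(\overline Y)$. Given $X=X_1\uplus X_2$ and a split pair $(A,B)$ for $X$, split pairs $(A_i,B_i)$ for $X_i$ ($i=1,2$) are nice with respect to $(A,B)$ if $A\cap X_i\subseteq A_i$ and $B_{3-i}\cap X_i\subseteq A_i$ for both $i\in\{1,2\}$. -}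

module Defs where

open import Data.Nat using (ℕ)
open import Data.Fin using (Fin)
open import Data.Bool using (Bool; true; false; _∧_; _∨_; _xor_; not; if_then_else_)
open import Data.List using (List; foldr)
open import Data.List.Base using (allFin)
open import Relation.Binary.PropositionalEquality using (_≡_)
open import Data.Product using (Σ; _×_)

record Graph (n : ℕ) : Set where
  field
    adj   : Fin n → Fin n → Bool
    sym   : ∀ u v → adj u v ≡ adj v u
    irrefl : ∀ v → adj v v ≡ false
open Graph public

VSet : ℕ → Set
VSet n = Fin n → Bool

co : ∀ {n} → VSet n → VSet n
co Y v = not (Y v)

_⊆_ : ∀ {n} → VSet n → VSet n → Set
S ⊆ T = ∀ v → S v ≡ true → T v ≡ true

_∩_ : ∀ {n} → VSet n → VSet n → VSet n
(S ∩ T) v = S v ∧ T v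

-- Vectors over F₂ indexed by vertices.  An element of F₂^{\overline Y} is
-- represented by a vector that vanishes outside \overline Y.
F2Vec : ℕ → Set
F2Vec n = Fin n → Bool

zeroV : ∀ {n} → F2Vec n
zeroV _ = false

_+V_ : ∀ {n} → F2Vec n → F2Vec n → F2Vec n
(x +V y) w = x w xor y w

_≐_ : ∀ {n} → F2Vec n → F2Vec n → Set
x ≐ y = ∀ w → x w ≡ y w

xvec : ∀ {n} → Graph n → VSet n → Fin n → F2Vec n
xvec G Y v w = adj G v w ∧ not (Y w)

sumOver : ∀ {n} → VSet n → (Fin n → F2Vec n) → F2Vec n
sumOver {n} T f = foldr (λ i acc → if T i then f i +V acc else acc) zeroV (allFin n)

LinIndep : ∀ {n} → (Fin n → F2Vec n) → VSet n → Set
LinIndep f A = ∀ T → T ⊆ A → sumOver T f ≐ zeroV → ∀ v → T v ≡ false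

Spans : ∀ {n} → (Fin n → F2Vec n) → VSet n → VSet n → Set
Spans {n} f A Y = ∀ v → Y v ≡ true → Σ (VSet n) (λ T → T ⊆ A × f v ≐ sumOver T f)

IsBasisFor : ∀ {n} → Graph n → VSet n → VSet n → Set
IsBasisFor G Y A = A ⊆ Y × (LinIndep (xvec G Y) A × Spans (xvec G Y) A Y)

SplitPair : ∀ {n} → Graph n → VSet n → VSet n → VSet n → Set
SplitPair G Y A B = IsBasisFor G Y A × IsBasisFor G (co Y) B

Nice : ∀ {n} → VSet n → VSet n → VSet n → VSet n
     → VSet n → VSet n → VSet n → VSet n → Set
Nice X₁ X₂ A B A₁ B₁ A₂ B₂ =
  ((A ∩ X₁) ⊆ A₁ × (A ∩ X₂) ⊆ A₂) × ((B₂ ∩ X₁) ⊆ A₁ × (B₁ ∩ X₂) ⊆ A₂)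

module Submission where

-- Write x_Y for the adjacency vectors of Defs.  The proof is elementary linear
-- algebra over F₂ plus one observation: if Z ⊆ Y then x_Y(v) is x_Z(v) with
-- the coordinates in Y ∖ Z erased (a "masking").  Hence a set independent for
-- x_Y is independent for x_Z, and span relations for x_Z descend to x_Y.
--
-- For X = X₁ ⊎ X₂ and a split pair (A,B) for X, one "half" of the theorem is:
--   * A₁ : A ∩ X₁ is independent for x_{X₁}; extend it to a basis for X₁;
--   * B₂ : \overline{X₂} = X₁ ∪ \overline X, so A₁ ∪ B spans
--     x_{\overline{X₂}}(\overline{X₂}); pick a basis B₂ ⊆ A₁ ∪ B.
-- Since A₁ ⊆ X and B ⊆ \overline X, we get B₂ ∩ X₁ ⊆ A₁ and
-- B₂ ∩ \overline X ⊆ B.  The theorem is this half for (X₁,X₂) and (X₂,X₁).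

open import Defs hiding (sym)
open import Data.Nat using (ℕ)
open import Data.Bool using (true; false; _∨_; _∧_; not; _xor_; if_then_else_)
open import Data.Bool.Properties using (xor-assoc; xor-identityʳ; ∧-conicalˡ; ∧-conicalʳ; ∧-distribʳ-xor; ∧-zeroʳ; ∨-comm; ∧-comm)
import Data.Bool.Properties as Bool
open import Data.Fin using (Fin; _≟_)
open import Data.Fin.Properties using (all?)
open import Data.Fin.Subset using (Subset)
open import Data.Fin.Subset.Properties using (anySubset?)
open import Data.Vec using (lookup; tabulate)
open import Data.Vec.Properties using (lookup∘tabulate)
open import Data.List using (List; []; _∷_; foldr)
open import Data.List.Base using (allFin)
open import Data.List.Relation.Unary.AllPairs using (AllPairs; _∷_)
import Data.List.Relation.Unary.All as All
open import Data.List.Relation.Unary.Any using (here; there)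
open import Data.List.Membership.Propositional using (_∈_; _∉_)
open import Data.List.Membership.Propositional.Properties using (∈-allFin)
open import Data.List.Relation.Unary.Unique.Propositional.Properties using (allFin⁺)
open import Data.Product using (Σ; _×_; _,_; proj₁)
open import Data.Sum using (_⊎_; inj₁; inj₂)
open import Data.Empty using (⊥; ⊥-elim)
open import Relation.Nullary using (Dec; yes; no; ¬_; does)
open import Relation.Nullary.Decidable using (_×-dec_; map′)
open import Relation.Binary.PropositionalEquality
  using (_≡_; _≢_; refl; sym; trans; cong; cong₂; module ≡-Reasoning)

private
  variable
    n : ℕ

false≢true : false ≡ true → ⊥
false≢true ()

∨-introˡ : ∀ a b → a ≡ true → a ∨ b ≡ true
∨-introˡ true b _ = refl

∨-introʳ : ∀ a b → b ≡ true → a ∨ b ≡ true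
∨-introʳ true  b _ = refl
∨-introʳ false b h = h

∨-elim : ∀ a b → a ∨ b ≡ true → a ≡ true ⊎ b ≡ true
∨-elim true  b _ = inj₁ refl
∨-elim false b h = inj₂ h

∨-resolve : ∀ a b → b ≡ false → a ∨ b ≡ true → a ≡ true
∨-resolve true  b     _ _ = refl
∨-resolve false false _ h = h

not-true : ∀ a → not a ≡ true → a ≡ false
not-true false _ = refl

not-false : ∀ a → a ≡ false → not a ≡ true
not-false false _ = refl

xor-cancel : ∀ a b c → (a xor b) xor (a xor c) ≡ b xor c
xor-cancel true  true  true  = refl
xor-cancel true  true  false = refl
xor-cancel true  false true  = refl
xor-cancel true  false false = refl
xor-cancel false b     c     = refl

xor-swap : ∀ a b c → a xor (b xor c) ≡ b xor (a xor c)
xor-swap true  true  true  = refl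
xor-swap true  true  false = refl
xor-swap true  false c     = refl
xor-swap false true  c     = refl
xor-swap false false c     = refl

xor-false⇒≡ : ∀ a b → a xor b ≡ false → b ≡ a
xor-false⇒≡ true  true  _ = refl
xor-false⇒≡ false false _ = refl

_∪_ : VSet n → VSet n → VSet n
(S ∪ T) v = S v ∨ T v

Disjoint : VSet n → VSet n → Set
Disjoint S T = ∀ v → S v ≡ true → T v ≡ true → ⊥

⊆-refl : {S : VSet n} → S ⊆ S
⊆-refl _ h = h

⊆-trans : {S T U : VSet n} → S ⊆ T → T ⊆ U → S ⊆ U
⊆-trans s t v h = t v (s v h)

co-anti : {S T : VSet n} → S ⊆ T → co T ⊆ co S
co-anti {S = S} {T} s v h with S v in e
... | false = refl
... | true  = ⊥-elim (false≢true (trans (sym (not-true (T v) h)) (s v e)))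

disjoint-co : {S T U : VSet n} → S ⊆ co T → U ⊆ T → Disjoint S U
disjoint-co {T = T} S⊆coT U⊆T v s u =
  false≢true (trans (sym (not-true (T v) (S⊆coT v s))) (U⊆T v u))

disjoint-sym : {S T : VSet n} → Disjoint S T → Disjoint T S
disjoint-sym d v t s = d v s t

∪-swap : {J P Q : VSet n} → J ⊆ (P ∪ Q) → J ⊆ (Q ∪ P)
∪-swap {P = P} {Q} s v h = trans (∨-comm (Q v) (P v)) (s v h)

∪-∩-disjoint : {J P Q Z : VSet n} → J ⊆ (P ∪ Q) → Disjoint P Z → (J ∩ Z) ⊆ Q
∪-∩-disjoint {J = J} {P} {Q} {Z} s d v h with ∨-elim (P v) (Q v) (s v (∧-conicalˡ (J v) _ h))
... | inj₁ p = ⊥-elim (d v p (∧-conicalʳ (J v) _ h))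
... | inj₂ q = q

singleton : Fin n → VSet n
singleton v u = does (u ≟ v)

singleton-self : (v : Fin n) → singleton v v ≡ true
singleton-self v with v ≟ v
... | yes _ = refl
... | no v≢v = ⊥-elim (v≢v refl)

singleton-eq : (u v : Fin n) → singleton v u ≡ true → u ≡ v
singleton-eq u v h with u ≟ v
... | yes u≡v = u≡v
... | no _ = ⊥-elim (false≢true h)

singleton-other : (u v : Fin n) → u ≢ v → singleton v u ≡ false
singleton-other u v u≢v with u ≟ v
... | yes u≡v = ⊥-elim (u≢v u≡v)
... | no _ = refl

sumL : List (Fin n) → VSet n → (Fin n → F2Vec n) → F2Vec n
sumL L T f = foldr (λ i acc → if T i then f i +V acc else acc) zeroV L

sumL-cong : (L : List (Fin n)) {S T : VSet n} (f : Fin n → F2Vec n)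
  → (∀ v → S v ≡ T v) → sumL L S f ≐ sumL L T f
sumL-cong []      f eq w = refl
sumL-cong (x ∷ L) {S} {T} f eq w rewrite eq x with T x
... | true  = cong (f x w xor_) (sumL-cong L f eq w)
... | false = sumL-cong L f eq w

sumL-empty : (L : List (Fin n)) (f : Fin n → F2Vec n) → sumL L (λ _ → false) f ≐ zeroV
sumL-empty []      f w = refl
sumL-empty (x ∷ L) f w = sumL-empty L f w

sumL-xor : (L : List (Fin n)) (S T : VSet n) (f : Fin n → F2Vec n) (w : Fin n)
  → sumL L (λ v → S v xor T v) f w ≡ sumL L S f w xor sumL L T f w
sumL-xor []      S T f w = refl
sumL-xor (x ∷ L) S T f w with S x | T x | sumL-xor L S T f w
... | true  | true  | ih = trans ih (sym (xor-cancel (f x w) (sumL L S f w) (sumL L T f w)))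
... | true  | false | ih = trans (cong (f x w xor_) ih) (sym (xor-assoc (f x w) (sumL L S f w) (sumL L T f w)))
... | false | true  | ih = trans (cong (f x w xor_) ih) (xor-swap (f x w) (sumL L S f w) (sumL L T f w))
... | false | false | ih = ih

sumL-singleton-∉ : (L : List (Fin n)) (v : Fin n) (f : Fin n → F2Vec n)
  → v ∉ L → sumL L (singleton v) f ≐ zeroV
sumL-singleton-∉ []      v f v∉ w = refl
sumL-singleton-∉ (x ∷ L) v f v∉ w with x ≟ v
... | yes x≡v = ⊥-elim (v∉ (here (sym x≡v)))
... | no _ = sumL-singleton-∉ L v f (λ m → v∉ (there m)) w

sumL-singleton : (L : List (Fin n)) (v : Fin n) (f : Fin n → F2Vec n)
  → AllPairs _≢_ L → v ∈ L → sumL L (singleton v) f ≐ f v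
sumL-singleton (x ∷ L) .x f (x∉L ∷ _) (here refl) w with x ≟ x
... | yes _ = trans (cong (f x w xor_) (sumL-singleton-∉ L x f (λ m → All.lookup x∉L m refl) w))
                    (xor-identityʳ (f x w))
... | no x≢x = ⊥-elim (x≢x refl)
sumL-singleton (x ∷ L) v f (x∉L ∷ distinct) (there v∈L) w with x ≟ v
... | yes refl = ⊥-elim (All.lookup x∉L v∈L refl)
... | no _ = sumL-singleton L v f distinct v∈L w

sumOver-singleton : (v : Fin n) (f : Fin n → F2Vec n) → sumOver (singleton v) f ≐ f v
sumOver-singleton {n} v f = sumL-singleton (allFin n) v f (allFin⁺ n) (∈-allFin v)

record IsMasking (g f : Fin n → F2Vec n) (m : F2Vec n) : Set where
  constructor masking
  field masked : ∀ v w → g v w ≡ f v w ∧ m w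
open IsMasking

sumL-masking : (L : List (Fin n)) (T : VSet n) {f g : Fin n → F2Vec n} {m : F2Vec n}
  → IsMasking g f m → ∀ w → sumL L T g w ≡ sumL L T f w ∧ m w
sumL-masking []      T gm w = refl
sumL-masking (x ∷ L) T {f} {g} {m} gm w with T x
... | true  rewrite masked gm x w | sumL-masking L T gm w =
  sym (∧-distribʳ-xor (m w) (f x w) (sumL L T f w))
... | false = sumL-masking L T gm w

InSpan : (Fin n → F2Vec n) → VSet n → F2Vec n → Set
InSpan {n} f J x = Σ (VSet n) λ T → T ⊆ J × x ≐ sumOver T f

span-mono : {f : Fin n → F2Vec n} {J J' : VSet n} {x : F2Vec n}
  → J ⊆ J' → InSpan f J x → InSpan f J' x
span-mono J⊆J' (T , T⊆J , eq) = T , ⊆-trans T⊆J J⊆J' , eq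

span-zero : {f : Fin n → F2Vec n} {J : VSet n} → InSpan f J zeroV
span-zero {n} {f} = (λ _ → false) , (λ _ ()) , λ w → sym (sumL-empty (allFin n) f w)

span-add : {f : Fin n → F2Vec n} {J : VSet n} {x y : F2Vec n}
  → InSpan f J x → InSpan f J y → InSpan f J (x +V y)
span-add {n} {f} {J} (S , S⊆J , x≐) (T , T⊆J , y≐) =
  (λ v → S v xor T v) , support ,
  λ w → trans (cong₂ _xor_ (x≐ w) (y≐ w)) (sym (sumL-xor (allFin n) S T f w))
  where
    support : (λ v → S v xor T v) ⊆ J
    support v h with S v in e
    ... | true  = S⊆J v e
    ... | false = T⊆J v h

span-generator : (f : Fin n → F2Vec n) {J : VSet n} (v : Fin n) → J v ≡ true → InSpan f J (f v)
span-generator f {J} v v∈J =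
  singleton v , support , λ w → sym (sumOver-singleton v f w)
  where
    support : singleton v ⊆ J
    support u h with singleton-eq u v h
    ... | refl = v∈J

span-trans : {f : Fin n → F2Vec n} {S J : VSet n} {x : F2Vec n}
  → InSpan f S x → (∀ s → S s ≡ true → InSpan f J (f s)) → InSpan f J x
span-trans {n} {f} {S} {J} (T , T⊆S , x≐) gens =
  let (U , U⊆J , eq) = sumL-span (allFin n) in U , U⊆J , λ w → trans (x≐ w) (eq w)
  where
    sumL-span : ∀ L → InSpan f J (sumL L T f)
    sumL-span []      = span-zero {f = f}
    sumL-span (x ∷ L) with T x in e
    ... | true  = span-add {f = f} (gens x (T⊆S x e)) (sumL-span L)
    ... | false = sumL-span L

span-masking : {f g : Fin n → F2Vec n} {m : F2Vec n} {S : VSet n}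
  → IsMasking g f m → ∀ y → InSpan f S (f y) → InSpan g S (g y)
span-masking {n} {f} {g} {m} gm y (T , T⊆S , fy≐) =
  T , T⊆S , λ w → trans (masked gm y w)
                   (trans (cong (_∧ m w) (fy≐ w)) (sym (sumL-masking (allFin n) T gm w)))

⊆? : (S J : VSet n) → Dec (S ⊆ J)
⊆? S J = all? (λ v → implies? (S v) (J v))
  where
    implies? : ∀ a b → Dec (a ≡ true → b ≡ true)
    implies? false b     = yes (λ ())
    implies? true  true  = yes (λ _ → refl)
    implies? true  false = no (λ h → false≢true (h refl))

≐? : (x y : F2Vec n) → Dec (x ≐ y)
≐? x y = all? (λ w → x w Bool.≟ y w)

span? : (f : Fin n → F2Vec n) (J : VSet n) (x : F2Vec n) → Dec (InSpan f J x)
span? {n} f J x =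
  map′ toSpan fromSpan (anySubset? (λ s → ⊆? (lookup s) J ×-dec ≐? x (sumOver (lookup s) f)))
  where
    toSpan : Σ (Subset n) (λ s → lookup s ⊆ J × x ≐ sumOver (lookup s) f) → InSpan f J x
    toSpan (s , s⊆J , eq) = lookup s , s⊆J , eq
    fromSpan : InSpan f J x → Σ (Subset n) (λ s → lookup s ⊆ J × x ≐ sumOver (lookup s) f)
    fromSpan (T , T⊆J , eq) =
      tabulate T , (λ v h → T⊆J v (trans (sym (lookup∘tabulate T v)) h)) ,
      λ w → trans (eq w) (sumL-cong (allFin n) f (λ v → sym (lookup∘tabulate T v)) w)

indep-unmask : {f g : Fin n → F2Vec n} {m : F2Vec n} {A : VSet n}
  → IsMasking g f m → LinIndep g A → LinIndep f A
indep-unmask {n} {f} {m = m} gm indep T T⊆A Σf≐0 =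
  indep T T⊆A λ w → trans (sumL-masking (allFin n) T gm w) (cong (_∧ m w) (Σf≐0 w))

remove-singleton : (T : VSet n) (v : Fin n) → T v ≡ true
  → ∀ u → T u ≡ (T u ∧ not (singleton v u)) xor singleton v u
remove-singleton T v Tv u with u ≟ v
... | yes refl rewrite Tv = refl
... | no _ with T u
... | true  = refl
... | false = refl

indep-insert : (f : Fin n → F2Vec n) (J : VSet n) (v : Fin n)
  → LinIndep f J → ¬ InSpan f J (f v) → LinIndep f (J ∪ singleton v)
indep-insert {n} f J v indep v∉span T T⊆ Σ≐0 with T v in Tv
... | false = indep T T⊆J Σ≐0
  where
    T⊆J : T ⊆ J
    T⊆J u h with u ≟ v
    ... | yes refl = ⊥-elim (false≢true (trans (sym Tv) h))
    ... | no u≢v = ∨-resolve (J u) _ (singleton-other u v u≢v) (T⊆ u h)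
... | true = ⊥-elim (v∉span (T' , T'⊆J , fv≐))
  where
    T' : VSet n
    T' u = T u ∧ not (singleton v u)
    T'⊆J : T' ⊆ J
    T'⊆J u h with u ≟ v
    ... | yes refl = ⊥-elim (false≢true (trans (sym (∧-zeroʳ (T v))) h))
    ... | no u≢v = ∨-resolve (J u) _ (singleton-other u v u≢v) (T⊆ u (∧-conicalˡ (T u) _ h))
    fv≐ : f v ≐ sumOver T' f
    fv≐ w = xor-false⇒≡ (sumOver T' f w) (f v w) (begin
      sumOver T' f w xor f v w
        ≡⟨ cong (sumOver T' f w xor_) (sym (sumOver-singleton v f w)) ⟩
      sumOver T' f w xor sumOver (singleton v) f w
        ≡⟨ sym (sumL-xor (allFin n) T' (singleton v) f w) ⟩
      sumL (allFin n) (λ u → T' u xor singleton v u) f w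
        ≡⟨ sym (sumL-cong (allFin n) f (remove-singleton T v Tv) w) ⟩
      sumOver T f w
        ≡⟨ Σ≐0 w ⟩
      false ∎)
      where open ≡-Reasoning

indep-empty : (f : Fin n → F2Vec n) → LinIndep f (λ _ → false)
indep-empty f T T⊆∅ _ v with T v in e
... | false = refl
... | true  = ⊥-elim (false≢true (T⊆∅ v e))

record Extension (f : Fin n → F2Vec n) (U I : VSet n) (L : List (Fin n)) : Set where
  field
    set         : VSet n
    grows       : I ⊆ set
    within      : set ⊆ U
    independent : LinIndep f set
    covers      : ∀ u → u ∈ L → U u ≡ true → InSpan f set (f u)
open Extension

cover-head : {f : Fin n → F2Vec n} {U I : VSet n} {L : List (Fin n)} {x : Fin n}
  → (E : Extension f U I L) → (U x ≡ true → InSpan f (set E) (f x))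
  → Extension f U I (x ∷ L)
cover-head E new = record
  { set = set E ; grows = grows E ; within = within E ; independent = independent E
  ; covers = λ { u (here refl) Ux → new Ux ; u (there u∈L) Ux → covers E u u∈L Ux } }

shrink-base : {f : Fin n → F2Vec n} {U I I' : VSet n} {L : List (Fin n)}
  → I' ⊆ I → Extension f U I L → Extension f U I' L
shrink-base I'⊆I E = record
  { set = set E ; grows = ⊆-trans I'⊆I (grows E) ; within = within E
  ; independent = independent E ; covers = covers E }

greedy : (f : Fin n → F2Vec n) (U : VSet n) (L : List (Fin n)) (J : VSet n)
  → J ⊆ U → LinIndep f J → Extension f U J L
greedy f U [] J J⊆U indep =
  record { set = J ; grows = ⊆-refl ; within = J⊆U ; independent = indep ; covers = λ _ () }
greedy f U (x ∷ L) J J⊆U indep with U x in Ux | span? f J (f x)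
... | false | _ =
  cover-head (greedy f U L J J⊆U indep) (λ h → ⊥-elim (false≢true (trans (sym Ux) h)))
... | true | yes x∈span =
  let E = greedy f U L J J⊆U indep in cover-head E (λ _ → span-mono {f = f} (grows E) x∈span)
... | true | no x∉span =
  let E = greedy f U L (J ∪ singleton x) J'⊆U (indep-insert f J x indep x∉span)
      x∈E = grows E x (∨-introʳ (J x) _ (singleton-self x))
  in cover-head (shrink-base (λ v → ∨-introˡ (J v) _) E) (λ _ → span-generator f x x∈E)
  where
    J'⊆U : (J ∪ singleton x) ⊆ U
    J'⊆U v h with ∨-elim (J v) (singleton x v) h
    ... | inj₁ v∈J = J⊆U v v∈J
    ... | inj₂ v-is-x with singleton-eq v x v-is-x
    ... | refl = Ux

Basis : (Fin n → F2Vec n) → VSet n → VSet n → Set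
Basis f Y J = J ⊆ Y × LinIndep f J × Spans f J Y

extend-to-basis : (f : Fin n → F2Vec n) {Y I : VSet n} → I ⊆ Y → LinIndep f I
  → Σ (VSet n) λ J → Basis f Y J × I ⊆ J
extend-to-basis {n} f {Y} {I} I⊆Y indep =
  set E , (within E , independent E , λ y y∈Y → covers E y (∈-allFin y) y∈Y) , grows E
  where
    E : Extension f Y I (allFin n)
    E = greedy f Y (allFin n) I I⊆Y indep

basis-within : (f : Fin n → F2Vec n) {Y U : VSet n} → U ⊆ Y
  → (∀ y → Y y ≡ true → InSpan f U (f y))
  → Σ (VSet n) λ J → Basis f Y J × J ⊆ U
basis-within {n} f {Y} {U} U⊆Y U-spans =
  set E , (⊆-trans (within E) U⊆Y , independent E , spans) , within E
  where
    E : Extension f U (λ _ → false) (allFin n)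
    E = greedy f U (allFin n) (λ _ → false) (λ _ ()) (indep-empty f)
    spans : Spans f (set E) Y
    spans y y∈Y = span-trans (U-spans y y∈Y) (λ u u∈U → covers E u (∈-allFin u) u∈U)

xvec-masking : (G : Graph n) {Y Z : VSet n} → Z ⊆ Y
  → IsMasking (xvec G Y) (xvec G Z) (co Y)
xvec-masking G {Y} {Z} Z⊆Y = masking λ v w → erase (adj G v w) (Z w) (Y w) (Z⊆Y w)
  where
    erase : ∀ a z y → (z ≡ true → y ≡ true) → a ∧ not y ≡ (a ∧ not z) ∧ not y
    erase true  true  true  _ = refl
    erase true  true  false h with h refl
    ... | ()
    erase true  false y     _ = refl
    erase false z     y     _ = refl

restrict-basis : (G : Graph n) {Y Z A : VSet n} → Z ⊆ Y → IsBasisFor G Y A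
  → Σ (VSet n) λ A' → IsBasisFor G Z A' × (A ∩ Z) ⊆ A'
restrict-basis G {Y} {Z} {A} Z⊆Y (_ , indepA , _) =
  extend-to-basis (xvec G Z) (λ v h → ∧-conicalʳ (A v) _ h) indep∩
  where
    indep∩ : LinIndep (xvec G Z) (A ∩ Z)
    indep∩ = indep-unmask (xvec-masking G Z⊆Y)
               (λ T T⊆ → indepA T (λ v h → ∧-conicalˡ (A v) _ (T⊆ v h)))

basis-of-union : (G : Graph n) {Y Z₁ Z₂ A₁ A₂ : VSet n}
  → Z₁ ⊆ Y → Z₂ ⊆ Y → Y ⊆ (Z₁ ∪ Z₂)
  → IsBasisFor G Z₁ A₁ → IsBasisFor G Z₂ A₂
  → Σ (VSet n) λ J → IsBasisFor G Y J × J ⊆ (A₁ ∪ A₂)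
basis-of-union G {Y} {Z₁} {Z₂} {A₁} {A₂} Z₁⊆Y Z₂⊆Y Y⊆ (A₁⊆Z₁ , _ , spans₁) (A₂⊆Z₂ , _ , spans₂) =
  basis-within (xvec G Y) A₁∪A₂⊆Y spansY
  where
    A₁∪A₂⊆Y : (A₁ ∪ A₂) ⊆ Y
    A₁∪A₂⊆Y v h with ∨-elim (A₁ v) (A₂ v) h
    ... | inj₁ v∈A₁ = Z₁⊆Y v (A₁⊆Z₁ v v∈A₁)
    ... | inj₂ v∈A₂ = Z₂⊆Y v (A₂⊆Z₂ v v∈A₂)
    spansY : ∀ y → Y y ≡ true → InSpan (xvec G Y) (A₁ ∪ A₂) (xvec G Y y)
    spansY y y∈Y with ∨-elim (Z₁ y) (Z₂ y) (Y⊆ y y∈Y)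
    ... | inj₁ y∈Z₁ = span-mono {f = xvec G Y} (λ v → ∨-introˡ (A₁ v) (A₂ v))
                        (span-masking (xvec-masking G Z₁⊆Y) y (spans₁ y y∈Z₁))
    ... | inj₂ y∈Z₂ = span-mono {f = xvec G Y} (λ v → ∨-introʳ (A₁ v) (A₂ v))
                        (span-masking (xvec-masking G Z₂⊆Y) y (spans₂ y y∈Z₂))

half : (G : Graph n) (X X₁ X₂ A B : VSet n)
  → (∀ v → X v ≡ (X₁ v ∨ X₂ v)) → (∀ v → (X₁ v ∧ X₂ v) ≡ false)
  → SplitPair G X A B
  → Σ (VSet n) λ A₁ → Σ (VSet n) λ B₂ →
      IsBasisFor G X₁ A₁ × IsBasisFor G (co X₂) B₂
      × (A ∩ X₁) ⊆ A₁ × (B₂ ∩ X₁) ⊆ A₁ × (B₂ ∩ co X) ⊆ B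
half G X X₁ X₂ A B cover disjoint (basisA , basisB) =
  let (A₁ , basisA₁ , A∩X₁⊆A₁) = restrict-basis G X₁⊆X basisA
      (B₂ , basisB₂ , B₂⊆A₁∪B) = basis-of-union G X₁⊆coX₂ coX⊆coX₂ coX₂⊆X₁∪coX basisA₁ basisB
      A₁⊆X = ⊆-trans (proj₁ basisA₁) X₁⊆X
  in A₁ , B₂ , basisA₁ , basisB₂ , A∩X₁⊆A₁
     , ∪-∩-disjoint (∪-swap {P = A₁} B₂⊆A₁∪B) (disjoint-co (proj₁ basisB) X₁⊆X)
     , ∪-∩-disjoint B₂⊆A₁∪B (disjoint-sym (disjoint-co ⊆-refl A₁⊆X))
  where
    X₁⊆X : X₁ ⊆ X
    X₁⊆X v h = trans (cover v) (∨-introˡ (X₁ v) _ h)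
    coX⊆coX₂ : co X ⊆ co X₂
    coX⊆coX₂ = co-anti (λ v h → trans (cover v) (∨-introʳ (X₁ v) _ h))
    X₁⊆coX₂ : X₁ ⊆ co X₂
    X₁⊆coX₂ v h = not-false (X₂ v) (trans (cong (_∧ X₂ v) (sym h)) (disjoint v))
    coX₂⊆X₁∪coX : co X₂ ⊆ (X₁ ∪ co X)
    coX₂⊆X₁∪coX v h with X₁ v in e
    ... | true  = refl
    ... | false = not-false (X v) (trans (cover v) (trans (cong (_∨ X₂ v) e) (not-true (X₂ v) h)))

lemma4p2 : ∀ {n : ℕ} (G : Graph n) (X X₁ X₂ A B : VSet n)
    → (∀ v → X v ≡ (X₁ v ∨ X₂ v))
    → (∀ v → (X₁ v ∧ X₂ v) ≡ false)
    → SplitPair G X A B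
    → Σ (VSet n) λ A₁ → Σ (VSet n) λ B₁ → Σ (VSet n) λ A₂ → Σ (VSet n) λ B₂ →
        SplitPair G X₁ A₁ B₁ × SplitPair G X₂ A₂ B₂
        × Nice X₁ X₂ A B A₁ B₁ A₂ B₂
        × ((B₁ ∩ co X) ⊆ B × (B₂ ∩ co X) ⊆ B)
lemma4p2 G X X₁ X₂ A B cover disjoint split =
  let (A₁ , B₂ , basisA₁ , basisB₂ , A∩X₁⊆A₁ , B₂∩X₁⊆A₁ , B₂∩coX⊆B) =
        half G X X₁ X₂ A B cover disjoint split
      (A₂ , B₁ , basisA₂ , basisB₁ , A∩X₂⊆A₂ , B₁∩X₂⊆A₂ , B₁∩coX⊆B) =
        half G X X₂ X₁ A B cover′ disjoint′ split
  in A₁ , B₁ , A₂ , B₂ , (basisA₁ , basisB₁) , (basisA₂ , basisB₂)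
     , ((A∩X₁⊆A₁ , A∩X₂⊆A₂) , (B₂∩X₁⊆A₁ , B₁∩X₂⊆A₂)) , (B₁∩coX⊆B , B₂∩coX⊆B)
  where
    cover′ : ∀ v → X v ≡ (X₂ v ∨ X₁ v)
    cover′ v = trans (cover v) (∨-comm (X₁ v) (X₂ v))
    disjoint′ : ∀ v → (X₂ v ∧ X₁ v) ≡ false
    disjoint′ v = trans (∧-comm (X₂ v) (X₁ v)) (disjoint v)
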